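{- Let $\mathcal U$ be a universe and $P$ a family of propositions over $\mathcal U$ such that $\mathcal U$ is $P$-univalent, i.e. for all $A_0,A_1:\mathcal U$ with $P(A_0)$ and $P(A_1)$ the canonical map $(A_0 = A_1) \to (A_0\simeq A_1)$ is an equivalence. Let $X$ be a type and $Y : X\to\mathcal U$. Then $(X,Y)$ is $P$-univalent (for all $x_0,x_1:X$ with $P(Y(x_0))$ and $P(Y(x_1))$ the canonical map $(x_0 = x_1)\to (Y(x_0)\simeq Y(x_1))$ is an equivalence) if and only if the restriction of $Y$ to the subtype $\sum_{x:X} P(Y(x))$ is an embedding.
   Context: Homotopy type theory. A map $f : A \to B$ is an embedding if for all $a_0, a_1 : A$ the map $\mathrm{ap}_f : (a_0 = a_1) \to (f(a_0) = f(a_1))$ is an equivalence. -}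

{-# OPTIONS --without-K #-}
module Defs where

open import Level using (Level; _⊔_; suc)
open import Data.Product using (Σ; _×_; _,_; proj₁; proj₂)
open import Relation.Binary.PropositionalEquality using (_≡_; refl)
open import Function using (_∘_; id)

_∼_ : ∀ {a b} {A : Set a} {B : A → Set b} (f g : (x : A) → B x) → Set (a ⊔ b)
f ∼ g = ∀ x → f x ≡ g x

isEquiv : ∀ {a b} {A : Set a} {B : Set b} → (A → B) → Set (a ⊔ b)
isEquiv {A = A} {B} f =
  (Σ (B → A) λ g → (f ∘ g) ∼ id) × (Σ (B → A) λ h → (h ∘ f) ∼ id)

_≃_ : ∀ {a b} → Set a → Set b → Set (a ⊔ b)
A ≃ B = Σ (A → B) isEquiv

idEquiv : ∀ {a} (A : Set a) → A ≃ A
idEquiv A = id , ((id , λ _ → refl) , (id , λ _ → refl))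

isProp : ∀ {a} → Set a → Set a
isProp A = (x y : A) → x ≡ y

ap : ∀ {a b} {A : Set a} {B : Set b} (f : A → B) {x y : A} → x ≡ y → f x ≡ f y
ap f refl = refl

isEmbedding : ∀ {a b} {A : Set a} {B : Set b} → (A → B) → Set (a ⊔ b)
isEmbedding {A = A} f = (a₀ a₁ : A) → isEquiv (ap f {a₀} {a₁})

idtoeqv : ∀ {ℓ} {A₀ A₁ : Set ℓ} → A₀ ≡ A₁ → A₀ ≃ A₁
idtoeqv {A₀ = A} refl = idEquiv A

pathToEquivFam : ∀ {ℓ ℓ'} {X : Set ℓ'} (Y : X → Set ℓ) {x₀ x₁ : X} →
  x₀ ≡ x₁ → Y x₀ ≃ Y x₁
pathToEquivFam Y {x₀} refl = idEquiv (Y x₀)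

isPUnivalentUniverse : ∀ {ℓ ℓp} → (P : Set ℓ → Set ℓp) → Set (suc ℓ ⊔ ℓp)
isPUnivalentUniverse {ℓ} P =
  (A₀ A₁ : Set ℓ) → P A₀ → P A₁ → isEquiv (idtoeqv {A₀ = A₀} {A₁})

isPUnivalentFamily : ∀ {ℓ ℓ' ℓp} (P : Set ℓ → Set ℓp) {X : Set ℓ'} →
  (X → Set ℓ) → Set (ℓ ⊔ ℓ' ⊔ ℓp)
isPUnivalentFamily P {X} Y =
  (x₀ x₁ : X) → P (Y x₀) → P (Y x₁) → isEquiv (pathToEquivFam Y {x₀} {x₁})

restrict : ∀ {ℓ ℓ' ℓp} (P : Set ℓ → Set ℓp) {X : Set ℓ'} (Y : X → Set ℓ) →
  Σ X (λ x → P (Y x)) → Set ℓ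
restrict P Y = Y ∘ proj₁

module Submission where

-- Proof idea.  Fix points u = (x₀ , p₀) and v = (x₁ , p₁) of the subtype
-- Σ X (P ∘ Y).  The two maps whose invertibility is compared factor as
--
--   pathToEquivFam Y  ∼  idtoeqv ∘ ap Y                (on x₀ ≡ x₁)
--   ap (Y ∘ proj₁)    ∼  ap Y ∘ ap proj₁               (on u ≡ v)
--
-- Here idtoeqv is an equivalence by P-univalence of the universe (p₀, p₁
-- witness P (Y x₀) and P (Y x₁)), and ap proj₁ is an equivalence because
-- P is proposition-valued (projections out of subtypes are embeddings).
-- By the two-out-of-three property of equivalences, stated as logical
-- equivalences, each of the two maps is an equivalence iff ap Y is.

open import Defs
open import Level using (_⊔_)
open import Data.Product using (Σ; _×_; _,_; proj₁)
open import Relation.Binary.PropositionalEquality using (_≡_; refl; sym; trans; cong; subst)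
open import Function using (_∘_; id)
open import Function.Bundles using (_⇔_; mk⇔; Equivalence)
import Function.Properties.Equivalence as ⇔

module _ {a b} {A : Set a} {B : Set b} where

  qinv : (A → B) → Set (a ⊔ b)
  qinv f = Σ (B → A) λ g → ((f ∘ g) ∼ id) × ((g ∘ f) ∼ id)

  -- A bi-invertible map has a quasi-inverse: its section g is also a
  -- retraction, since g ∼ h ∘ f ∘ g ∼ h for the retraction h.
  isEquiv→qinv : {f : A → B} → isEquiv f → qinv f
  isEquiv→qinv {f} ((g , fg) , (h , hf)) =
    g , fg , λ x → trans (sym (hf (g (f x)))) (trans (cong h (fg (f x))) (hf x))

  qinv→isEquiv : {f : A → B} → qinv f → isEquiv f
  qinv→isEquiv (g , fg , gf) = (g , fg) , (g , gf)

  isEquiv-∼ : {f g : A → B} → f ∼ g → isEquiv f → isEquiv g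
  isEquiv-∼ {f} {g} f∼g e with isEquiv→qinv e
  ... | k , fk , kf =
    qinv→isEquiv ( k
                 , (λ y → trans (sym (f∼g (k y))) (fk y))
                 , (λ x → trans (cong k (sym (f∼g x))) (kf x)))

  isEquiv-∼⇔ : {f g : A → B} → f ∼ g → isEquiv f ⇔ isEquiv g
  isEquiv-∼⇔ f∼g = mk⇔ (isEquiv-∼ f∼g) (isEquiv-∼ (sym ∘ f∼g))

module _ {a b c} {A : Set a} {B : Set b} {C : Set c} where

  isEquiv-∘ : {f : A → B} {g : B → C} → isEquiv f → isEquiv g → isEquiv (g ∘ f)
  isEquiv-∘ {f} {g} ef eg with isEquiv→qinv ef | isEquiv→qinv eg
  ... | f⁻ , ff⁻ , f⁻f | g⁻ , gg⁻ , g⁻g =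
    qinv→isEquiv ( f⁻ ∘ g⁻
                 , (λ z → trans (cong g (ff⁻ (g⁻ z))) (gg⁻ z))
                 , (λ x → trans (cong f⁻ (g⁻g (f x))) (f⁻f x)))

  -- Cancelling an equivalence on the left: k ∘ g is an inverse of f,
  -- where k inverts g ∘ f.
  isEquiv-cancelˡ : {f : A → B} {g : B → C} → isEquiv g → isEquiv (g ∘ f) → isEquiv f
  isEquiv-cancelˡ {f} {g} eg egf with isEquiv→qinv eg | isEquiv→qinv egf
  ... | g⁻ , gg⁻ , g⁻g | k , gfk , kgf =
    qinv→isEquiv ( k ∘ g
                 , (λ y → trans (sym (g⁻g (f (k (g y)))))
                                (trans (cong g⁻ (gfk (g y))) (g⁻g y)))
                 , kgf)

  -- Cancelling an equivalence on the right: f ∘ k is an inverse of h,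
  -- where k inverts h ∘ f.
  isEquiv-cancelʳ : {f : A → B} {h : B → C} → isEquiv f → isEquiv (h ∘ f) → isEquiv h
  isEquiv-cancelʳ {f} {h} ef ehf with isEquiv→qinv ef | isEquiv→qinv ehf
  ... | f⁻ , ff⁻ , _ | k , hfk , khf =
    qinv→isEquiv ( f ∘ k
                 , hfk
                 , (λ y → subst (λ y' → f (k (h y')) ≡ y') (ff⁻ y) (cong f (khf (f⁻ y)))))

  isEquiv-postcomp⇔ : {f : A → B} {g : B → C} → isEquiv g → isEquiv f ⇔ isEquiv (g ∘ f)
  isEquiv-postcomp⇔ eg = mk⇔ (λ ef → isEquiv-∘ ef eg) (isEquiv-cancelˡ eg)

  isEquiv-precomp⇔ : {f : A → B} {h : B → C} → isEquiv f → isEquiv h ⇔ isEquiv (h ∘ f)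
  isEquiv-precomp⇔ ef = mk⇔ (isEquiv-∘ ef) (isEquiv-cancelʳ ef)

trans-symˡ : ∀ {a} {A : Set a} {x y : A} (p : x ≡ y) → trans (sym p) p ≡ refl
trans-symˡ refl = refl

module _ {ℓ ℓq} {X : Set ℓ} (Q : X → Set ℓq) (Q-prop : ∀ x → isProp (Q x)) where

  -- A normalised choice of paths in Q x, equal to refl on the diagonal.
  Q-path : ∀ x (q q' : Q x) → q ≡ q'
  Q-path x q q' = trans (sym (Q-prop x q q)) (Q-prop x q q')

  Q-path-diag : ∀ x (q : Q x) → Q-path x q q ≡ refl
  Q-path-diag x q = trans-symˡ (Q-prop x q q)

  liftPath : ∀ {x₀ x₁} {q₀ : Q x₀} {q₁ : Q x₁} →
    x₀ ≡ x₁ → _≡_ {A = Σ X Q} (x₀ , q₀) (x₁ , q₁)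
  liftPath {x₀} {q₀ = q₀} {q₁} refl = cong (x₀ ,_) (Q-path x₀ q₀ q₁)

  proj₁-isEmbedding : isEmbedding (proj₁ {B = Q})
  proj₁-isEmbedding (x₀ , q₀) (x₁ , q₁) = qinv→isEquiv (liftPath , section , retraction)
    where
    ap-proj₁-fibre : ∀ {x} {q q' : Q x} (e : q ≡ q') → ap proj₁ (cong (x ,_) e) ≡ refl
    ap-proj₁-fibre refl = refl

    section : (e : x₀ ≡ x₁) → ap proj₁ (liftPath {q₀ = q₀} {q₁} e) ≡ e
    section refl = ap-proj₁-fibre (Q-path x₀ q₀ q₁)

    retraction : (e : _≡_ {A = Σ X Q} (x₀ , q₀) (x₁ , q₁)) → liftPath (ap proj₁ e) ≡ e
    retraction refl = cong (cong (x₀ ,_)) (Q-path-diag x₀ q₀)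

pathToEquivFam-factor : ∀ {ℓ ℓ'} {X : Set ℓ'} (Y : X → Set ℓ) {x₀ x₁ : X} →
  (idtoeqv ∘ ap Y {x₀} {x₁}) ∼ pathToEquivFam Y
pathToEquivFam-factor Y refl = refl

ap-∘ : ∀ {a b c} {A : Set a} {B : Set b} {C : Set c} (f : A → B) (g : B → C) {x y : A} →
  (ap g ∘ ap f {x} {y}) ∼ ap (g ∘ f)
ap-∘ f g refl = refl

lemma2p3 : ∀ {ℓ ℓ' ℓp} (P : Set ℓ → Set ℓp) → ((A : Set ℓ) → isProp (P A)) →
    isPUnivalentUniverse P → {X : Set ℓ'} (Y : X → Set ℓ) →
    (isPUnivalentFamily P Y → isEmbedding (restrict P Y)) ×
    (isEmbedding (restrict P Y) → isPUnivalentFamily P Y)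
lemma2p3 P P-prop univ {X} Y =
    (λ fam (x₀ , p₀) (x₁ , p₁) → Equivalence.to (pointwise p₀ p₁) (fam x₀ x₁ p₀ p₁))
  , (λ emb x₀ x₁ p₀ p₁ → Equivalence.from (pointwise p₀ p₁) (emb (x₀ , p₀) (x₁ , p₁)))
  where
  pointwise : ∀ {x₀ x₁} (p₀ : P (Y x₀)) (p₁ : P (Y x₁)) →
    isEquiv (pathToEquivFam Y {x₀} {x₁}) ⇔ isEquiv (ap (restrict P Y) {x₀ , p₀} {x₁ , p₁})
  pointwise {x₀} {x₁} p₀ p₁ =
    ⇔.trans (⇔.sym (isEquiv-∼⇔ (pathToEquivFam-factor Y)))
    (⇔.trans (⇔.sym (isEquiv-postcomp⇔ (univ (Y x₀) (Y x₁) p₀ p₁)))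
    (⇔.trans (isEquiv-precomp⇔ (proj₁-isEmbedding (P ∘ Y) (P-prop ∘ Y) (x₀ , p₀) (x₁ , p₁)))
             (isEquiv-∼⇔ (ap-∘ proj₁ Y))))
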